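{- For $p,r\in\mathbb{N}$, \[ \sum_{n=1}^{\infty}\frac{h_{n}^{(-r)}}{n^{p}}=\zeta(p+1)+\sum_{k=1}^{r}(-1)^{k}\binom{r}{k}\left\{\frac{H_{k}}{k^{p}}+\sum_{j=2}^{p}\frac{H_{k}^{(j)}-\zeta(j)}{k^{p+1-j}}\right\}. \]
   Context: For $k\in\mathbb{N}$, $H_n^{(k)}=\sum_{i=1}^n i^{ -k}$, $H_n=H_n^{(1)}$. For $r\ge1$ and $n\ge1$ the hyperharmonic number of negative order is \[ h_n^{(-r)}=\begin{cases}\dfrac{(-1)^r}{(n-r)\binom{n}{r}}, & n>r\ge1,\\[2mm] \displaystyle\sum_{k=0}^{n-1}\binom{r}{k}\frac{(-1)^k}{n-k}, & r\ge n\ge1.\end{cases} \] $\zeta$ is the Riemann zeta function. -}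

module Defs where

open import Data.Nat as ℕ using (ℕ; zero; suc; _∸_; _<ᵇ_)
open import Data.Nat.Combinatorics using (_C_)
open import Data.Integer using (+_)
open import Data.Bool using (if_then_else_)
open import Data.Rational using (ℚ; 0ℚ; 1ℚ; _+_; _*_; _-_; -_; _/_)

toℚ : ℕ → ℚ
toℚ n = + n / 1

inv : ℕ → ℚ
inv zero    = 0ℚ
inv (suc m) = + 1 / suc m

pow : ℚ → ℕ → ℚ
pow x zero    = 1ℚ
pow x (suc k) = x * pow x k

sgn : ℕ → ℚ
sgn k = pow (- 1ℚ) k

-- Σ_{i=a}^{b} f i  (empty if b < a); defined as Σ_{i=0}^{len-1} f (a+i)
sumFrom : ℕ → ℕ → (ℕ → ℚ) → ℚ
sumFrom a zero    f = 0ℚ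
sumFrom a (suc l) f = f a + sumFrom (suc a) l f

ΣFT : ℕ → ℕ → (ℕ → ℚ) → ℚ
ΣFT a b f = sumFrom a (suc b ∸ a) f

H : ℕ → ℕ → ℚ
H n k = ΣFT 1 n (λ i → pow (inv i) k)

-- hyperharmonic number of negative order h_n^{(-r)} (r ≥ 1, n ≥ 1)
hneg : ℕ → ℕ → ℚ
hneg r n = if r <ᵇ n
  then sgn r * inv ((n ∸ r) ℕ.* (n C r))
  else ΣFT 0 (n ∸ 1) (λ k → toℚ (r C k) * sgn k * inv (n ∸ k))

zetaPartial : ℕ → ℕ → ℚ
zetaPartial s M = H M s

lhsPartial : ℕ → ℕ → ℕ → ℚ
lhsPartial p r M = ΣFT 1 M (λ n → hneg r n * pow (inv n) p)

-- right-hand side with every ζ(s) replaced by its M-th partial sum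
rhsApprox : ℕ → ℕ → ℕ → ℚ
rhsApprox p r M =
  zetaPartial (suc p) M +
  ΣFT 1 r (λ k → sgn k * toℚ (r C k) *
    (H k 1 * pow (inv k) p +
     ΣFT 2 p (λ j → (H k j - zetaPartial j M) * pow (inv k) (suc p ∸ j))))

{-# OPTIONS --safe #-}
module Submission where

-- Partial fractions give h_n^{(-r)} = Σ_{k=0}^{r} (-1)^k C(r,k)/(n-k) for every n ≥ 1 (terms with
-- k ≥ n read as 0), so the M-th partial sum of the left side is
-- H^{(p+1)}_M + Σ_{k=1}^{r} (-1)^k C(r,k) T_k(M) with T_k(M) = Σ_{n=k+1}^{M} 1/((n-k) n^p).
-- Applying 1/((n-k) n) = (1/k)(1/(n-k) - 1/n) p times shows that T_k(M) is the k-th bracket of the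
-- right side, with every ζ(j) replaced by H^{(j)}_M, up to the error k^{-p} (H_{M-k} - H_M) → 0.
-- So the two sides have asymptotically equal partial sums, and these are Cauchy because
-- H^{(j)}_M + 1/M decreases in M for j ≥ 2.

open import Defs
open import Data.Bool using (true; false; T)
open import Data.Integer as ℤ using (ℤ)
import Data.Integer.Properties as ℤ
open import Data.Integer.Tactic.RingSolver using () renaming (solve-∀ to ℤ-solve-∀)
open import Data.Maybe using (Maybe; just; nothing)
open import Data.Nat as ℕ using (ℕ; zero; suc; z≤n; s≤s; _∸_; _≤_; _<ᵇ_)
import Data.Nat.Properties as ℕ
open import Data.Nat.Combinatorics using (_C_; nC1≡n; nCk+nC[k+1]≡[n+1]C[k+1]; k>n⇒nCk≡0)
open import Data.Nat.Tactic.RingSolver using () renaming (solve-∀ to ℕ-solve-∀)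
open import Data.Product using (_×_; _,_; proj₁; proj₂; map₂; ∃-syntax)
open import Data.Rational as ℚ using (ℚ; toℚᵘ; 0ℚ; 1ℚ; ½; _+_; _*_; _-_; -_; ∣_∣; _<_; 1/_)
open import Data.Rational.Properties
open import Data.Rational.Unnormalised as ℚᵘ using (mkℚᵘ)
import Data.Rational.Unnormalised.Properties as ℚᵘ
open import Data.Sum using (_⊎_; inj₁; inj₂)
open import Data.Unit using (tt)
open import Level using (0ℓ)
open import Relation.Binary.PropositionalEquality
open import Relation.Nullary using (yes; no)
open import Tactic.RingSolver using (solve-∀)
import Tactic.RingSolver.Core.AlmostCommutativeRing as ACR

ℚ-ring : ACR.AlmostCommutativeRing 0ℓ 0ℓ
ℚ-ring = ACR.fromCommutativeRing +-*-commutativeRing isZero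
  where
  isZero : ∀ x → Maybe (0ℚ ≡ x)
  isZero x with 0ℚ ≟ x
  ... | yes 0≡x = just 0≡x
  ... | no _    = nothing

p≤p+q : ∀ {p q} → 0ℚ ℚ.≤ q → p ℚ.≤ p + q
p≤p+q {p} {q} 0≤q = subst (ℚ._≤ p + q) (+-identityʳ p) (+-monoʳ-≤ p 0≤q)

p≤q⇒0≤q-p : ∀ {p q} → p ℚ.≤ q → 0ℚ ℚ.≤ q - p
p≤q⇒0≤q-p {p} {q} p≤q = subst (ℚ._≤ q - p) (+-inverseʳ p) (+-monoˡ-≤ (- p) p≤q)

∣p-q∣≡∣q-p∣ : ∀ p q → ∣ p - q ∣ ≡ ∣ q - p ∣
∣p-q∣≡∣q-p∣ p q = trans (cong ∣_∣ (negate p q)) (∣-p∣≡∣p∣ (q - p))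
  where
  negate : ∀ p q → p - q ≡ - (q - p)
  negate = solve-∀ ℚ-ring

sumFrom-cong : ∀ a l {f g : ℕ → ℚ} → (∀ i → a ≤ i → i ℕ.< a ℕ.+ l → f i ≡ g i) →
               sumFrom a l f ≡ sumFrom a l g
sumFrom-cong a zero    f≡g = refl
sumFrom-cong a (suc l) f≡g = cong₂ _+_ (f≡g a ℕ.≤-refl (ℕ.m<m+n a ℕ.z<s))
  (sumFrom-cong (suc a) l λ i a<i i<a+1+l →
    f≡g i (ℕ.<⇒≤ a<i) (subst (i ℕ.<_) (sym (ℕ.+-suc a l)) i<a+1+l))

sumFrom-ext : ∀ a l {f g : ℕ → ℚ} → (∀ i → f i ≡ g i) → sumFrom a l f ≡ sumFrom a l g
sumFrom-ext a l f≡g = sumFrom-cong a l (λ i _ _ → f≡g i)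

sumFrom-zero : ∀ a l {f : ℕ → ℚ} → (∀ i → a ≤ i → f i ≡ 0ℚ) → sumFrom a l f ≡ 0ℚ
sumFrom-zero a zero    f≡0 = refl
sumFrom-zero a (suc l) f≡0 = cong₂ _+_ (f≡0 a ℕ.≤-refl) (sumFrom-zero (suc a) l λ i a<i → f≡0 i (ℕ.<⇒≤ a<i))

sumFrom-+ : ∀ a l (f g : ℕ → ℚ) → sumFrom a l (λ i → f i + g i) ≡ sumFrom a l f + sumFrom a l g
sumFrom-+ a zero    f g = refl
sumFrom-+ a (suc l) f g =
  trans (cong ((f a + g a) +_) (sumFrom-+ (suc a) l f g)) (interchange (f a) (g a) _ _)
  where
  interchange : ∀ a b c d → (a + b) + (c + d) ≡ (a + c) + (b + d)
  interchange = solve-∀ ℚ-ring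

sumFrom-- : ∀ a l (f g : ℕ → ℚ) → sumFrom a l (λ i → f i - g i) ≡ sumFrom a l f - sumFrom a l g
sumFrom-- a zero    f g = refl
sumFrom-- a (suc l) f g =
  trans (cong ((f a - g a) +_) (sumFrom-- (suc a) l f g)) (interchange (f a) (g a) _ _)
  where
  interchange : ∀ a b c d → (a - b) + (c - d) ≡ (a + c) - (b + d)
  interchange = solve-∀ ℚ-ring

sumFrom-*ˡ : ∀ a l c (f : ℕ → ℚ) → sumFrom a l (λ i → c * f i) ≡ c * sumFrom a l f
sumFrom-*ˡ a zero    c f = sym (*-zeroʳ c)
sumFrom-*ˡ a (suc l) c f =
  trans (cong (c * f a +_) (sumFrom-*ˡ (suc a) l c f)) (sym (*-distribˡ-+ c (f a) _))

sumFrom-*ʳ : ∀ a l c (f : ℕ → ℚ) → sumFrom a l (λ i → f i * c) ≡ sumFrom a l f * c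
sumFrom-*ʳ a zero    c f = sym (*-zeroˡ c)
sumFrom-*ʳ a (suc l) c f =
  trans (cong (f a * c +_) (sumFrom-*ʳ (suc a) l c f)) (sym (*-distribʳ-+ c (f a) _))

sumFrom-suc : ∀ a l (f : ℕ → ℚ) → sumFrom (suc a) l f ≡ sumFrom a l (λ i → f (suc i))
sumFrom-suc a zero    f = refl
sumFrom-suc a (suc l) f = cong (f (suc a) +_) (sumFrom-suc (suc a) l f)

sumFrom-++ : ∀ a l m (f : ℕ → ℚ) → sumFrom a (l ℕ.+ m) f ≡ sumFrom a l f + sumFrom (a ℕ.+ l) m f
sumFrom-++ a zero    m f = trans (cong (λ b → sumFrom b m f) (sym (ℕ.+-identityʳ a))) (sym (+-identityˡ _))
sumFrom-++ a (suc l) m f = begin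
  f a + sumFrom (suc a) (l ℕ.+ m) f                          ≡⟨ cong (f a +_) (sumFrom-++ (suc a) l m f) ⟩
  f a + (sumFrom (suc a) l f + sumFrom (suc a ℕ.+ l) m f)    ≡⟨ sym (+-assoc (f a) _ _) ⟩
  sumFrom a (suc l) f + sumFrom (suc a ℕ.+ l) m f            ≡⟨ cong (λ b → sumFrom a (suc l) f + sumFrom b m f) (sym (ℕ.+-suc a l)) ⟩
  sumFrom a (suc l) f + sumFrom (a ℕ.+ suc l) m f            ∎
  where open ≡-Reasoning

sumFrom-snoc : ∀ a l (f : ℕ → ℚ) → sumFrom a (suc l) f ≡ sumFrom a l f + f (a ℕ.+ l)
sumFrom-snoc a l f = begin
  sumFrom a (suc l) f                           ≡⟨ cong (λ n → sumFrom a n f) (ℕ.+-comm 1 l) ⟩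
  sumFrom a (l ℕ.+ 1) f                         ≡⟨ sumFrom-++ a l 1 f ⟩
  sumFrom a l f + (f (a ℕ.+ l) + 0ℚ)            ≡⟨ cong (sumFrom a l f +_) (+-identityʳ _) ⟩
  sumFrom a l f + f (a ℕ.+ l)                   ∎
  where open ≡-Reasoning

sumFrom-comm : ∀ a l b m (f : ℕ → ℕ → ℚ) →
  sumFrom a l (λ i → sumFrom b m (f i)) ≡ sumFrom b m (λ j → sumFrom a l (λ i → f i j))
sumFrom-comm a zero    b m f = sym (sumFrom-zero b m (λ _ _ → refl))
sumFrom-comm a (suc l) b m f =
  trans (cong (sumFrom b m (f a) +_) (sumFrom-comm (suc a) l b m f))
        (sym (sumFrom-+ b m (f a) (λ j → sumFrom (suc a) l (λ i → f i j))))

sumFrom-nonNeg : ∀ a l (f : ℕ → ℚ) → (∀ i → 0ℚ ℚ.≤ f i) → 0ℚ ℚ.≤ sumFrom a l f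
sumFrom-nonNeg a zero    f 0≤f = ≤-refl
sumFrom-nonNeg a (suc l) f 0≤f = +-mono-≤ (0≤f a) (sumFrom-nonNeg (suc a) l f 0≤f)

-- By definition toℚ n and inv (suc n) are fromℚᵘ of the unnormalised fractions n/1 and 1/(n+1).
fromℚᵘ-homo-+ : ∀ p q → ℚ.fromℚᵘ (p ℚᵘ.+ q) ≡ ℚ.fromℚᵘ p + ℚ.fromℚᵘ q
fromℚᵘ-homo-+ p q = toℚᵘ-injective (ℚᵘ.≃-trans (toℚᵘ-fromℚᵘ (p ℚᵘ.+ q)) (ℚᵘ.≃-sym
  (ℚᵘ.≃-trans (toℚᵘ-homo-+ (ℚ.fromℚᵘ p) (ℚ.fromℚᵘ q)) (ℚᵘ.+-cong (toℚᵘ-fromℚᵘ p) (toℚᵘ-fromℚᵘ q)))))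

fromℚᵘ-homo-* : ∀ p q → ℚ.fromℚᵘ (p ℚᵘ.* q) ≡ ℚ.fromℚᵘ p * ℚ.fromℚᵘ q
fromℚᵘ-homo-* p q = toℚᵘ-injective (ℚᵘ.≃-trans (toℚᵘ-fromℚᵘ (p ℚᵘ.* q)) (ℚᵘ.≃-sym
  (ℚᵘ.≃-trans (toℚᵘ-homo-* (ℚ.fromℚᵘ p) (ℚ.fromℚᵘ q)) (ℚᵘ.*-cong (toℚᵘ-fromℚᵘ p) (toℚᵘ-fromℚᵘ q)))))

toℚ-+ : ∀ m n → toℚ (m ℕ.+ n) ≡ toℚ m + toℚ n
toℚ-+ m n = trans (fromℚᵘ-cong {mkℚᵘ (ℤ.+ (m ℕ.+ n)) 0} {mkℚᵘ (ℤ.+ m) 0 ℚᵘ.+ mkℚᵘ (ℤ.+ n) 0}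
                    (ℚᵘ.*≡* (trans (cong (ℤ._* ℤ.+ 1) (ℤ.pos-+ m n)) (shape (ℤ.+ m) (ℤ.+ n)))))
                  (fromℚᵘ-homo-+ (mkℚᵘ (ℤ.+ m) 0) (mkℚᵘ (ℤ.+ n) 0))
  where
  shape : ∀ a b → (a ℤ.+ b) ℤ.* ℤ.+ 1 ≡ (a ℤ.* ℤ.+ 1 ℤ.+ b ℤ.* ℤ.+ 1) ℤ.* ℤ.+ 1
  shape = ℤ-solve-∀

toℚ-* : ∀ m n → toℚ (m ℕ.* n) ≡ toℚ m * toℚ n
toℚ-* m n = trans (fromℚᵘ-cong {mkℚᵘ (ℤ.+ (m ℕ.* n)) 0} {mkℚᵘ (ℤ.+ m) 0 ℚᵘ.* mkℚᵘ (ℤ.+ n) 0}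
                    (ℚᵘ.*≡* (cong (ℤ._* ℤ.+ 1) (ℤ.pos-* m n))))
                  (fromℚᵘ-homo-* (mkℚᵘ (ℤ.+ m) 0) (mkℚᵘ (ℤ.+ n) 0))

toℚ*inv≡1 : ∀ n → toℚ (suc n) * inv (suc n) ≡ 1ℚ
toℚ*inv≡1 n = trans (sym (fromℚᵘ-homo-* (mkℚᵘ (ℤ.+ suc n) 0) (mkℚᵘ (ℤ.+ 1) n)))
                    (fromℚᵘ-cong {mkℚᵘ (ℤ.+ suc n) 0 ℚᵘ.* mkℚᵘ (ℤ.+ 1) n} {mkℚᵘ (ℤ.+ 1) 0} (ℚᵘ.*≡* (cong ℤ.+[1+_] (shape n))))
  where
  shape : ∀ n → n ℕ.* 1 ℕ.* 1 ≡ n ℕ.+ 0 ℕ.+ 0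
  shape = ℕ-solve-∀

inv*inv-partialFraction : ∀ k m → 1 ≤ k →
  inv (suc m) * inv (suc (k ℕ.+ m)) ≡ inv k * (inv (suc m) - inv (suc (k ℕ.+ m)))
inv*inv-partialFraction (suc k) m _ = begin
  x * y                                  ≡⟨ sym (*-identityʳ (x * y)) ⟩
  x * y * 1ℚ                             ≡⟨ cong (x * y *_) (sym (toℚ*inv≡1 k)) ⟩
  x * y * (K * z)                        ≡⟨ expand x y z A K ⟩
  z * (x * ((A + K) * y) - y * (A * x))  ≡⟨ cong (λ B → z * (x * (B * y) - y * (A * x))) (sym B≡A+K) ⟩
  z * (x * (B * y) - y * (A * x))        ≡⟨ cong₂ (λ s t → z * (x * s - y * t)) (toℚ*inv≡1 (suc k ℕ.+ m)) (toℚ*inv≡1 m) ⟩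
  z * (x * 1ℚ - y * 1ℚ)                  ≡⟨ cong₂ (λ s t → z * (s - t)) (*-identityʳ x) (*-identityʳ y) ⟩
  z * (x - y)                            ∎
  where
  open ≡-Reasoning
  x = inv (suc m)
  y = inv (suc (suc k ℕ.+ m))
  z = inv (suc k)
  A = toℚ (suc m)
  B = toℚ (suc (suc k ℕ.+ m))
  K = toℚ (suc k)
  B≡A+K : B ≡ A + K
  B≡A+K = trans (cong (λ n → toℚ (suc n)) (ℕ.+-comm (suc k) m)) (toℚ-+ (suc m) (suc k))
  expand : ∀ x y z A K → x * y * (K * z) ≡ z * (x * ((A + K) * y) - y * (A * x))
  expand = solve-∀ ℚ-ring

-- The hypothesis is ab = c(b - a) without truncated subtraction.
inv-difference : ∀ a b c → 1 ≤ a → 1 ≤ b → 1 ≤ c →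
  a ℕ.* b ℕ.+ c ℕ.* a ≡ c ℕ.* b → inv c ≡ inv a - inv b
inv-difference (suc a) (suc b) (suc c) _ _ _ ab+ca≡cb = begin
  w                                  ≡⟨ sym (*-identityʳ w) ⟩
  w * 1ℚ                             ≡⟨ cong (w *_) (sym (toℚ*inv≡1 a)) ⟩
  w * (A * u)                        ≡⟨ sym (*-identityʳ _) ⟩
  w * (A * u) * 1ℚ                   ≡⟨ cong (w * (A * u) *_) (sym (toℚ*inv≡1 b)) ⟩
  w * (A * u) * (B * v)              ≡⟨ regroup w u v A B ⟩
  u * v * w * (A * B)                ≡⟨ cong (u * v * w *_) AB≡CB-CA ⟩
  u * v * w * (C * B - C * A)        ≡⟨ distribute u v w A B C ⟩
  u * (B * v) * (C * w) - v * (A * u) * (C * w)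
    ≡⟨ cong₂ (λ s t → u * s * t - v * (A * u) * t) (toℚ*inv≡1 b) (toℚ*inv≡1 c) ⟩
  u * 1ℚ * 1ℚ - v * (A * u) * 1ℚ    ≡⟨ cong (λ s → u * 1ℚ * 1ℚ - v * s * 1ℚ) (toℚ*inv≡1 a) ⟩
  u * 1ℚ * 1ℚ - v * 1ℚ * 1ℚ         ≡⟨ unit u v ⟩
  u - v                              ∎
  where
  open ≡-Reasoning
  u = inv (suc a)
  v = inv (suc b)
  w = inv (suc c)
  A = toℚ (suc a)
  B = toℚ (suc b)
  C = toℚ (suc c)
  AB+CA≡CB : A * B + C * A ≡ C * B
  AB+CA≡CB = begin
    A * B + C * A                               ≡⟨ cong₂ _+_ (sym (toℚ-* (suc a) (suc b))) (sym (toℚ-* (suc c) (suc a))) ⟩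
    toℚ (suc a ℕ.* suc b) + toℚ (suc c ℕ.* suc a) ≡⟨ sym (toℚ-+ (suc a ℕ.* suc b) _) ⟩
    toℚ (suc a ℕ.* suc b ℕ.+ suc c ℕ.* suc a)   ≡⟨ cong toℚ ab+ca≡cb ⟩
    toℚ (suc c ℕ.* suc b)                       ≡⟨ toℚ-* (suc c) (suc b) ⟩
    C * B                                       ∎
  AB≡CB-CA : A * B ≡ C * B - C * A
  AB≡CB-CA = trans (sym (cancel (A * B) (C * A))) (cong (_- C * A) AB+CA≡CB)
    where
    cancel : ∀ s t → s + t - t ≡ s
    cancel = solve-∀ ℚ-ring
  regroup : ∀ w u v A B → w * (A * u) * (B * v) ≡ u * v * w * (A * B)
  regroup = solve-∀ ℚ-ring
  distribute : ∀ u v w A B C → u * v * w * (C * B - C * A) ≡ u * (B * v) * (C * w) - v * (A * u) * (C * w)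
  distribute = solve-∀ ℚ-ring
  unit : ∀ u v → u * 1ℚ * 1ℚ - v * 1ℚ * 1ℚ ≡ u - v
  unit = solve-∀ ℚ-ring

inv-nonNeg : ∀ n → 0ℚ ℚ.≤ inv n
inv-nonNeg zero    = ≤-refl
inv-nonNeg (suc n) = nonNegative⁻¹ (inv (suc n)) {{normalize-nonNeg 1 (suc n)}}

inv-antimono : ∀ m n → 1 ≤ m → m ≤ n → inv n ℚ.≤ inv m
inv-antimono (suc m) (suc n) _ m≤n = toℚᵘ-cancel-≤
  (ℚᵘ.≤-respʳ-≃ (ℚᵘ.≃-sym (toℚᵘ-fromℚᵘ (mkℚᵘ (ℤ.+ 1) m)))
  (ℚᵘ.≤-respˡ-≃ (ℚᵘ.≃-sym (toℚᵘ-fromℚᵘ (mkℚᵘ (ℤ.+ 1) n)))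
  (ℚᵘ.*≤* (subst₂ ℤ._≤_ (sym (ℤ.*-identityˡ (ℤ.+ suc m))) (sym (ℤ.*-identityˡ (ℤ.+ suc n)))
                        (ℤ.+≤+ m≤n)))))

inv≤1 : ∀ n → inv n ℚ.≤ 1ℚ
inv≤1 zero    = nonNegative⁻¹ 1ℚ
inv≤1 (suc n) = inv-antimono 1 (suc n) ℕ.≤-refl (s≤s z≤n)

pascal : ∀ n k → suc n C suc k ≡ n C k ℕ.+ n C suc k
pascal n k = sym (nCk+nC[k+1]≡[n+1]C[k+1] n k)

k≤n⇒nCk>0 : ∀ {n k} → k ≤ n → 1 ≤ n C k
k≤n⇒nCk>0 {n}     {zero}  _         = s≤s z≤n
k≤n⇒nCk>0 {suc n} {suc k} (s≤s k≤n) =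
  subst (1 ≤_) (sym (pascal n k)) (ℕ.≤-trans (k≤n⇒nCk>0 k≤n) (ℕ.m≤m+n _ _))

[k+1]*nC[k+1]≡[n∸k]*nCk : ∀ n k → suc k ℕ.* (n C suc k) ≡ (n ∸ k) ℕ.* (n C k)
[k+1]*nC[k+1]≡[n∸k]*nCk zero k = begin
  suc k ℕ.* (0 C suc k)  ≡⟨ cong (suc k ℕ.*_) (k>n⇒nCk≡0 {0} {suc k} (s≤s z≤n)) ⟩
  suc k ℕ.* 0            ≡⟨ ℕ.*-zeroʳ (suc k) ⟩
  0                      ≡⟨ cong (ℕ._* (0 C k)) (sym (ℕ.0∸n≡0 k)) ⟩
  (0 ∸ k) ℕ.* (0 C k)    ∎
  where open ≡-Reasoning
[k+1]*nC[k+1]≡[n∸k]*nCk (suc n) zero =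
  trans (ℕ.+-identityʳ _) (trans (nC1≡n (suc n)) (sym (ℕ.*-identityʳ (suc n))))
[k+1]*nC[k+1]≡[n∸k]*nCk (suc n) (suc k) with suc k ℕ.≤? n
... | yes k<n = begin
  suc (suc k) ℕ.* (suc n C suc (suc k))                      ≡⟨ cong (suc (suc k) ℕ.*_) (pascal n (suc k)) ⟩
  suc (suc k) ℕ.* (X ℕ.+ n C suc (suc k))                    ≡⟨ ℕ.*-distribˡ-+ (suc (suc k)) X _ ⟩
  suc (suc k) ℕ.* X ℕ.+ suc (suc k) ℕ.* (n C suc (suc k))    ≡⟨ cong (suc (suc k) ℕ.* X ℕ.+_) ([k+1]*nC[k+1]≡[n∸k]*nCk n (suc k)) ⟩
  suc (suc k) ℕ.* X ℕ.+ (n ∸ suc k) ℕ.* X                    ≡⟨ shift (suc k) (n ∸ suc k) X ⟩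
  suc k ℕ.* X ℕ.+ suc (n ∸ suc k) ℕ.* X                      ≡⟨ cong₂ ℕ._+_ ([k+1]*nC[k+1]≡[n∸k]*nCk n k) (cong (ℕ._* X) (sym (ℕ.+-∸-assoc 1 k<n))) ⟩
  (n ∸ k) ℕ.* (n C k) ℕ.+ (n ∸ k) ℕ.* X                      ≡⟨ sym (ℕ.*-distribˡ-+ (n ∸ k) (n C k) X) ⟩
  (n ∸ k) ℕ.* (n C k ℕ.+ X)                                  ≡⟨ cong ((n ∸ k) ℕ.*_) (sym (pascal n k)) ⟩
  (suc n ∸ suc k) ℕ.* (suc n C suc k)                        ∎
  where
  open ≡-Reasoning
  X = n C suc k
  shift : ∀ a b x → suc a ℕ.* x ℕ.+ b ℕ.* x ≡ a ℕ.* x ℕ.+ suc b ℕ.* x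
  shift = ℕ-solve-∀
... | no k≮n = begin
  suc (suc k) ℕ.* (suc n C suc (suc k))  ≡⟨ cong (suc (suc k) ℕ.*_) (k>n⇒nCk≡0 {suc n} (s≤s (s≤s n≤k))) ⟩
  suc (suc k) ℕ.* 0                      ≡⟨ ℕ.*-zeroʳ (suc (suc k)) ⟩
  0                                      ≡⟨ cong (ℕ._* (suc n C suc k)) (sym (ℕ.m≤n⇒m∸n≡0 n≤k)) ⟩
  (suc n ∸ suc k) ℕ.* (suc n C suc k)    ∎
  where
  open ≡-Reasoning
  n≤k : n ≤ k
  n≤k = ℕ.≤-pred (ℕ.≰⇒> k≮n)

-- Partial fractions for hyperharmonic numbers of negative order

hnegSum : ℕ → ℕ → ℚ
hnegSum r n = sumFrom 0 (suc r) (λ k → toℚ (r C k) * sgn k * inv (n ∸ k))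

hnegClosed : ℕ → ℕ → ℚ
hnegClosed r n = sgn r * inv ((n ∸ r) ℕ.* (n C r))

hnegSum-suc : ∀ r n → hnegSum (suc r) n ≡ hnegSum r n - hnegSum r (n ∸ 1)
hnegSum-suc r n = begin
  g 0 + sumFrom 1 (suc r) g′                                        ≡⟨ cong (g 0 +_) (sumFrom-suc 0 (suc r) g′) ⟩
  g 0 + sumFrom 0 (suc r) (λ k → g′ (suc k))                        ≡⟨ cong (g 0 +_) (sumFrom-ext 0 (suc r) pascalTerm) ⟩
  g 0 + sumFrom 0 (suc r) (λ k → g (suc k) - h k)                   ≡⟨ cong (g 0 +_) (sumFrom-- 0 (suc r) g∘suc h) ⟩
  g 0 + (sumFrom 0 (suc r) g∘suc - hnegSum r (n ∸ 1))            ≡⟨ cong (λ s → g 0 + (s - hnegSum r (n ∸ 1))) dropLast ⟩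
  g 0 + (sumFrom 1 r g - hnegSum r (n ∸ 1))                         ≡⟨ sym (+-assoc (g 0) _ _) ⟩
  hnegSum r n - hnegSum r (n ∸ 1)                                   ∎
  where
  open ≡-Reasoning
  g g′ h g∘suc : ℕ → ℚ
  g k = toℚ (r C k) * sgn k * inv (n ∸ k)
  g′ k = toℚ (suc r C k) * sgn k * inv (n ∸ k)
  h k = toℚ (r C k) * sgn k * inv ((n ∸ 1) ∸ k)
  g∘suc k = g (suc k)
  pascalTerm : ∀ k → g′ (suc k) ≡ g (suc k) - h k
  pascalTerm k = begin
    toℚ (suc r C suc k) * sgn (suc k) * inv (n ∸ suc k)
      ≡⟨ cong (λ c → c * sgn (suc k) * inv (n ∸ suc k)) (trans (cong toℚ (pascal r k)) (toℚ-+ (r C k) _)) ⟩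
    (toℚ (r C k) + toℚ (r C suc k)) * (- 1ℚ * sgn k) * inv (n ∸ suc k)
      ≡⟨ split (toℚ (r C k)) (toℚ (r C suc k)) (sgn k) (inv (n ∸ suc k)) ⟩
    g (suc k) - toℚ (r C k) * sgn k * inv (n ∸ suc k)
      ≡⟨ cong (λ m → g (suc k) - toℚ (r C k) * sgn k * inv m) (sym (ℕ.∸-+-assoc n 1 k)) ⟩
    g (suc k) - h k ∎
    where
    split : ∀ a b s i → (a + b) * (- 1ℚ * s) * i ≡ b * (- 1ℚ * s) * i - a * s * i
    split = solve-∀ ℚ-ring
  dropLast : sumFrom 0 (suc r) g∘suc ≡ sumFrom 1 r g
  dropLast = begin
    sumFrom 0 (suc r) g∘suc    ≡⟨ sym (sumFrom-suc 0 (suc r) g) ⟩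
    sumFrom 1 (suc r) g        ≡⟨ sumFrom-snoc 1 r g ⟩
    sumFrom 1 r g + g (suc r)  ≡⟨ cong (λ c → sumFrom 1 r g + toℚ c * sgn (suc r) * inv (n ∸ suc r)) (k>n⇒nCk≡0 (ℕ.n<1+n r)) ⟩
    sumFrom 1 r g + 0ℚ * sgn (suc r) * inv (n ∸ suc r)
      ≡⟨ cong (λ c → sumFrom 1 r g + c * inv (n ∸ suc r)) (*-zeroˡ (sgn (suc r))) ⟩
    sumFrom 1 r g + 0ℚ * inv (n ∸ suc r)  ≡⟨ cong (sumFrom 1 r g +_) (*-zeroˡ (inv (n ∸ suc r))) ⟩
    sumFrom 1 r g + 0ℚ         ≡⟨ +-identityʳ _ ⟩
    sumFrom 1 r g              ∎

hnegClosed-suc : ∀ r e → hnegClosed (suc r) (suc (suc (r ℕ.+ e))) ≡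
  hnegClosed r (suc (suc (r ℕ.+ e))) - hnegClosed r (suc (r ℕ.+ e))
hnegClosed-suc r e = begin
  - 1ℚ * sgn r * inv c            ≡⟨ cong (- 1ℚ * sgn r *_) (inv-difference a b c 1≤a 1≤b 1≤c ab+ca≡cb) ⟩
  - 1ℚ * sgn r * (inv a - inv b)  ≡⟨ flip (sgn r) (inv a) (inv b) ⟩
  sgn r * inv b - sgn r * inv a   ∎
  where
  open ≡-Reasoning
  m = suc (r ℕ.+ e)
  t = m ∸ r
  x = m C suc r
  y = m C r
  a = t ℕ.* y
  b = (suc m ∸ r) ℕ.* (suc m C r)
  c = t ℕ.* (suc m C suc r)
  r<m : r ℕ.< m
  r<m = s≤s (ℕ.m≤m+n r e)
  1≤t : 1 ≤ t
  1≤t = ℕ.m<n⇒0<n∸m r<m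
  1≤a : 1 ≤ a
  1≤a = ℕ.*-mono-≤ 1≤t (k≤n⇒nCk>0 (ℕ.<⇒≤ r<m))
  1≤b : 1 ≤ b
  1≤b = ℕ.*-mono-≤ (ℕ.m<n⇒0<n∸m (ℕ.m<n⇒m<1+n r<m)) (k≤n⇒nCk>0 (ℕ.<⇒≤ (ℕ.m<n⇒m<1+n r<m)))
  1≤c : 1 ≤ c
  1≤c = ℕ.*-mono-≤ 1≤t (k≤n⇒nCk>0 (s≤s (ℕ.<⇒≤ r<m)))
  b≡ : b ≡ suc r ℕ.* (y ℕ.+ x)
  b≡ = trans (sym ([k+1]*nC[k+1]≡[n∸k]*nCk (suc m) r)) (cong (suc r ℕ.*_) (pascal m r))
  c≡ : c ≡ t ℕ.* (y ℕ.+ x)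
  c≡ = cong (t ℕ.*_) (pascal m r)
  crossMultiplied : ∀ R t x y → R ℕ.* x ≡ t ℕ.* y →
    (t ℕ.* y) ℕ.* (R ℕ.* (y ℕ.+ x)) ℕ.+ (t ℕ.* (y ℕ.+ x)) ℕ.* (t ℕ.* y) ≡ (t ℕ.* (y ℕ.+ x)) ℕ.* (R ℕ.* (y ℕ.+ x))
  crossMultiplied R t x y Rx≡ty = begin
    (t ℕ.* y) ℕ.* (R ℕ.* (y ℕ.+ x)) ℕ.+ (t ℕ.* (y ℕ.+ x)) ℕ.* (t ℕ.* y) ≡⟨ factor R t x y ⟩
    t ℕ.* (y ℕ.+ x) ℕ.* (R ℕ.* y ℕ.+ t ℕ.* y)                           ≡⟨ cong (λ z → t ℕ.* (y ℕ.+ x) ℕ.* (R ℕ.* y ℕ.+ z)) (sym Rx≡ty) ⟩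
    t ℕ.* (y ℕ.+ x) ℕ.* (R ℕ.* y ℕ.+ R ℕ.* x)                           ≡⟨ unfactor R t x y ⟩
    (t ℕ.* (y ℕ.+ x)) ℕ.* (R ℕ.* (y ℕ.+ x))                             ∎
    where
    factor : ∀ R t x y → (t ℕ.* y) ℕ.* (R ℕ.* (y ℕ.+ x)) ℕ.+ (t ℕ.* (y ℕ.+ x)) ℕ.* (t ℕ.* y) ≡
                         t ℕ.* (y ℕ.+ x) ℕ.* (R ℕ.* y ℕ.+ t ℕ.* y)
    factor = ℕ-solve-∀
    unfactor : ∀ R t x y → t ℕ.* (y ℕ.+ x) ℕ.* (R ℕ.* y ℕ.+ R ℕ.* x) ≡ (t ℕ.* (y ℕ.+ x)) ℕ.* (R ℕ.* (y ℕ.+ x))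
    unfactor = ℕ-solve-∀
  ab+ca≡cb : a ℕ.* b ℕ.+ c ℕ.* a ≡ c ℕ.* b
  ab+ca≡cb = subst₂ (λ B C → a ℕ.* B ℕ.+ C ℕ.* a ≡ C ℕ.* B) (sym b≡) (sym c≡)
    (crossMultiplied (suc r) t x y ([k+1]*nC[k+1]≡[n∸k]*nCk m r))
  flip : ∀ s u v → - 1ℚ * s * (u - v) ≡ s * v - s * u
  flip = solve-∀ ℚ-ring

hnegClosed≡hnegSum : ∀ r e → hnegClosed r (suc (r ℕ.+ e)) ≡ hnegSum r (suc (r ℕ.+ e))
hnegClosed≡hnegSum zero e = trans (cong (λ d → 1ℚ * inv d) (ℕ.*-identityʳ (suc e))) (unit (inv (suc e)))
  where
  unit : ∀ x → 1ℚ * x ≡ 1ℚ * 1ℚ * x + 0ℚ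
  unit = solve-∀ ℚ-ring
hnegClosed≡hnegSum (suc r) e = begin
  hnegClosed (suc r) (suc (suc (r ℕ.+ e)))                             ≡⟨ hnegClosed-suc r e ⟩
  hnegClosed r (suc (suc (r ℕ.+ e))) - hnegClosed r (suc (r ℕ.+ e))    ≡⟨ cong₂ _-_ ih (hnegClosed≡hnegSum r e) ⟩
  hnegSum r (suc (suc (r ℕ.+ e))) - hnegSum r (suc (r ℕ.+ e))          ≡⟨ sym (hnegSum-suc r (suc (suc (r ℕ.+ e)))) ⟩
  hnegSum (suc r) (suc (suc (r ℕ.+ e)))                                ∎
  where
  open ≡-Reasoning
  ih : hnegClosed r (suc (suc (r ℕ.+ e))) ≡ hnegSum r (suc (suc (r ℕ.+ e)))
  ih = subst (λ n → hnegClosed r (suc n) ≡ hnegSum r (suc n)) (ℕ.+-suc r e) (hnegClosed≡hnegSum r (suc e))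

hneg≡hnegSum : ∀ r n → 1 ≤ n → hneg r n ≡ hnegSum r n
hneg≡hnegSum r (suc n) _ with r <ᵇ suc n in r<ᵇn
... | true  = subst (λ m → hnegClosed r m ≡ hnegSum r m) (ℕ.m+[n∸m]≡n r<1+n) (hnegClosed≡hnegSum r (n ∸ r))
  where
  r<1+n : r ℕ.< suc n
  r<1+n = ℕ.<ᵇ⇒< r (suc n) (subst T (sym r<ᵇn) tt)
... | false = sym (begin
  sumFrom 0 (suc r) f                                 ≡⟨ cong (λ l → sumFrom 0 l f) (sym (cong suc (ℕ.m+[n∸m]≡n (ℕ.<⇒≤ n<r)))) ⟩
  sumFrom 0 (suc n ℕ.+ (r ∸ n)) f                     ≡⟨ sumFrom-++ 0 (suc n) (r ∸ n) f ⟩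
  sumFrom 0 (suc n) f + sumFrom (suc n) (r ∸ n) f     ≡⟨ cong (sumFrom 0 (suc n) f +_) (sumFrom-zero (suc n) (r ∸ n) f≡0) ⟩
  sumFrom 0 (suc n) f + 0ℚ                            ≡⟨ +-identityʳ _ ⟩
  sumFrom 0 (suc n) f                                 ∎)
  where
  open ≡-Reasoning
  f : ℕ → ℚ
  f k = toℚ (r C k) * sgn k * inv (suc n ∸ k)
  n<r : n ℕ.< r
  n<r = ℕ.≮⇒≥ (λ r<1+n → subst T r<ᵇn (ℕ.<⇒<ᵇ r<1+n))
  f≡0 : ∀ k → suc n ≤ k → f k ≡ 0ℚ
  f≡0 k n<k = trans (cong (λ m → toℚ (r C k) * sgn k * inv m) (ℕ.m≤n⇒m∸n≡0 n<k)) (*-zeroʳ (toℚ (r C k) * sgn k))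

-- Eventually small families of rationals

-- Small u says that u tends to 0 along the filter generated by the sets {i | beyond N i}.
module Vanishing {I : Set} (beyond : ℕ → I → Set)
                 (beyond-antitone : ∀ {N N′ i} → N ≤ N′ → beyond N′ i → beyond N i) where

  Small : (I → ℚ) → Set
  Small u = ∀ ε → 0ℚ < ε → ∃[ N ] (∀ i → beyond N i → ∣ u i ∣ < ε)

  Small-mono : ∀ {u v : I → ℚ} N₀ → (∀ i → beyond N₀ i → ∣ u i ∣ ℚ.≤ ∣ v i ∣) → Small v → Small u
  Small-mono N₀ u≤v small-v ε ε>0 with small-v ε ε>0
  ... | N , v<ε = N₀ ℕ.⊔ N , λ i i≥ →
    ≤-<-trans (u≤v i (beyond-antitone (ℕ.m≤m⊔n N₀ N) i≥)) (v<ε i (beyond-antitone (ℕ.m≤n⊔m N₀ N) i≥))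

  Small-resp : ∀ {u v : I → ℚ} N₀ → (∀ i → beyond N₀ i → u i ≡ v i) → Small v → Small u
  Small-resp N₀ u≡v = Small-mono N₀ (λ i i≥ → ≤-reflexive (cong ∣_∣ (u≡v i i≥)))

  Small-0 : Small (λ _ → 0ℚ)
  Small-0 ε ε>0 = 0 , λ _ _ → ε>0

  Small-+ : ∀ {u v : I → ℚ} → Small u → Small v → Small (λ i → u i + v i)
  Small-+ {u} {v} small-u small-v ε ε>0
    with small-u (ε * ½) ε/2>0 | small-v (ε * ½) ε/2>0
    where ε/2>0 = positive⁻¹ (ε * ½) {{pos*pos⇒pos ε {{ℚ.positive ε>0}} ½}}
  ... | N₁ , u<ε/2 | N₂ , v<ε/2 = N₁ ℕ.⊔ N₂ , λ i i≥ → begin-strict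
    ∣ u i + v i ∣        ≤⟨ ∣p+q∣≤∣p∣+∣q∣ (u i) (v i) ⟩
    ∣ u i ∣ + ∣ v i ∣    <⟨ +-mono-< (u<ε/2 i (beyond-antitone (ℕ.m≤m⊔n N₁ N₂) i≥))
                                     (v<ε/2 i (beyond-antitone (ℕ.m≤n⊔m N₁ N₂) i≥)) ⟩
    ε * ½ + ε * ½        ≡⟨ halves ε ⟩
    ε                    ∎
    where
    open ≤-Reasoning
    halves : ∀ ε → ε * ½ + ε * ½ ≡ ε
    halves = solve-∀ ℚ-ring

  Small-*ˡ : ∀ {u : I → ℚ} c → Small u → Small (λ i → c * u i)
  Small-*ˡ {u} c small-u ε ε>0 = map₂ scaled (small-u (ε * 1/ A) ε/A>0)
    where
    A = ∣ c ∣ + 1ℚ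
    instance
      A-pos : ℚ.Positive A
      A-pos = nonNeg+pos⇒pos ∣ c ∣ {{∣-∣-nonNeg c}} 1ℚ
      A-nonZero : ℚ.NonZero A
      A-nonZero = pos⇒nonZero A
    ε/A>0 : 0ℚ < ε * 1/ A
    ε/A>0 = positive⁻¹ _ {{pos*pos⇒pos ε {{ℚ.positive ε>0}} (1/ A) {{1/pos⇒pos A}}}}
    ∣c∣≤A : ∣ c ∣ ℚ.≤ A
    ∣c∣≤A = p≤p+q (nonNegative⁻¹ 1ℚ)
    open ≤-Reasoning
    scaled : ∀ {N} → (∀ i → beyond N i → ∣ u i ∣ < ε * 1/ A) → ∀ i → beyond N i → ∣ c * u i ∣ < ε
    scaled u<ε/A i i≥ = begin-strict
      ∣ c * u i ∣          ≡⟨ ∣p*q∣≡∣p∣*∣q∣ c (u i) ⟩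
      ∣ c ∣ * ∣ u i ∣      ≤⟨ *-monoʳ-≤-nonNeg ∣ u i ∣ {{∣-∣-nonNeg (u i)}} ∣c∣≤A ⟩
      A * ∣ u i ∣          <⟨ *-monoʳ-<-pos A (u<ε/A i i≥) ⟩
      A * (ε * 1/ A)       ≡⟨ cong (A *_) (*-comm ε (1/ A)) ⟩
      A * (1/ A * ε)       ≡⟨ sym (*-assoc A (1/ A) ε) ⟩
      A * 1/ A * ε         ≡⟨ cong (_* ε) (*-inverseʳ A) ⟩
      1ℚ * ε               ≡⟨ *-identityˡ ε ⟩
      ε                    ∎

  Small-sum : ∀ a l (f : ℕ → I → ℚ) → (∀ k → a ≤ k → Small (f k)) → Small (λ i → sumFrom a l (λ k → f k i))
  Small-sum a zero    f small-f = Small-0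
  Small-sum a (suc l) f small-f =
    Small-+ (small-f a ℕ.≤-refl) (Small-sum (suc a) l f (λ k a<k → small-f k (ℕ.<⇒≤ a<k)))

module Seq = Vanishing (λ N M → N ≤ M) ℕ.≤-trans

module Pairs = Vanishing (λ N q → N ≤ proj₁ q × N ≤ proj₂ q)
                         (λ N≤N′ (N′≤M , N′≤M′) → ℕ.≤-trans N≤N′ N′≤M , ℕ.≤-trans N≤N′ N′≤M′)

Null : (ℕ → ℚ) → Set
Null = Seq.Small

Cauchy : (ℕ → ℚ) → Set
Cauchy s = Pairs.Small (λ q → s (proj₁ q) - s (proj₂ q))

inv-null : Null inv
inv-null (ℚ.mkℚ (ℤ.+ zero)   d _) (ℚ.*<* (ℤ.+<+ ()))
inv-null (ℚ.mkℚ ℤ.-[1+ k ]   d _) (ℚ.*<* ())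
inv-null ε@(ℚ.mkℚ ℤ.+[1+ k ] d _) _ = suc (suc d) , λ where
  (suc M) (s≤s d<M) → subst (_< ε) (sym (0≤p⇒∣p∣≡p (inv-nonNeg (suc M)))) (toℚᵘ-cancel-<
    (ℚᵘ.<-respˡ-≃ (ℚᵘ.≃-sym (toℚᵘ-fromℚᵘ (mkℚᵘ (ℤ.+ 1) M)))
      (ℚᵘ.*<* (subst₂ ℤ._<_ (sym (ℤ.*-identityˡ (ℤ.+ suc d))) (sym (ℤ.pos-* (suc k) (suc M)))
        (ℤ.+<+ (ℕ.<-≤-trans (s≤s d<M) (ℕ.m≤n*m (suc M) (suc k))))))))

Null-∘∸ : ∀ {s : ℕ → ℚ} k → Null s → Null (λ M → s (M ∸ k))
Null-∘∸ k null-s ε ε>0 with null-s ε ε>0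
... | N , s<ε = N ℕ.+ k , λ M N+k≤M → s<ε (M ∸ k) (subst (_≤ M ∸ k) (ℕ.m+n∸n≡m N k) (ℕ.∸-monoˡ-≤ k N+k≤M))

Null-∘π : ∀ {s : ℕ → ℚ} (π : ℕ × ℕ → ℕ) → (∀ {N q} → N ≤ proj₁ q × N ≤ proj₂ q → N ≤ π q) →
          Null s → Pairs.Small (λ q → s (π q))
Null-∘π π π-beyond null-s ε ε>0 = map₂ (λ s<ε q q≥ → s<ε (π q) (π-beyond q≥)) (null-s ε ε>0)

Null⇒Cauchy : ∀ {s : ℕ → ℚ} → Null s → Cauchy s
Null⇒Cauchy {s} null-s = Pairs.Small-resp 0 (λ q _ → minus (s (proj₁ q)) (s (proj₂ q)))
  (Pairs.Small-+ (Null-∘π proj₁ proj₁ null-s) (Pairs.Small-*ˡ (- 1ℚ) (Null-∘π proj₂ proj₂ null-s)))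
  where
  minus : ∀ a b → a - b ≡ a + - 1ℚ * b
  minus = solve-∀ ℚ-ring

Cauchy-const : ∀ c → Cauchy (λ _ → c)
Cauchy-const c = Pairs.Small-resp 0 (λ _ _ → +-inverseʳ c) Pairs.Small-0

Cauchy-+ : ∀ {s t : ℕ → ℚ} → Cauchy s → Cauchy t → Cauchy (λ M → s M + t M)
Cauchy-+ {s} {t} cauchy-s cauchy-t =
  Pairs.Small-resp 0 (λ (M , M′) _ → interchange (s M) (t M) (s M′) (t M′)) (Pairs.Small-+ cauchy-s cauchy-t)
  where
  interchange : ∀ a b c d → (a + b) - (c + d) ≡ (a - c) + (b - d)
  interchange = solve-∀ ℚ-ring

Cauchy-*ˡ : ∀ {s : ℕ → ℚ} c → Cauchy s → Cauchy (λ M → c * s M)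
Cauchy-*ˡ {s} c cauchy-s =
  Pairs.Small-resp 0 (λ (M , M′) _ → sym (*-distribˡ-- c (s M) (s M′))) (Pairs.Small-*ˡ c cauchy-s)
  where
  *-distribˡ-- : ∀ c a b → c * (a - b) ≡ c * a - c * b
  *-distribˡ-- = solve-∀ ℚ-ring

Cauchy-- : ∀ {s t : ℕ → ℚ} → Cauchy s → Cauchy t → Cauchy (λ M → s M - t M)
Cauchy-- {s} {t} cauchy-s cauchy-t =
  Pairs.Small-resp 0 (λ (M , M′) _ → interchange (s M) (t M) (s M′) (t M′))
    (Cauchy-+ {s} {λ M → - 1ℚ * t M} cauchy-s (Cauchy-*ˡ {t} (- 1ℚ) cauchy-t))
  where
  interchange : ∀ a b c d → (a - b) - (c - d) ≡ (a + - 1ℚ * b) - (c + - 1ℚ * d)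
  interchange = solve-∀ ℚ-ring

Cauchy-*ʳ : ∀ {s : ℕ → ℚ} c → Cauchy s → Cauchy (λ M → s M * c)
Cauchy-*ʳ {s} c cauchy-s =
  Pairs.Small-resp 0 (λ (M , M′) _ → cong₂ _-_ (*-comm (s M) c) (*-comm (s M′) c)) (Cauchy-*ˡ c cauchy-s)

Cauchy-sum : ∀ a l (f : ℕ → ℕ → ℚ) → (∀ k → a ≤ k → Cauchy (f k)) → Cauchy (λ M → sumFrom a l (λ k → f k M))
Cauchy-sum a l f cauchy-f =
  Pairs.Small-resp 0 (λ (M , M′) _ → sym (sumFrom-- a l (λ k → f k M) (λ k → f k M′)))
    (Pairs.Small-sum a l (λ k q → f k (proj₁ q) - f k (proj₂ q)) cauchy-f)

H[n]-H[n∸1]≡inv : ∀ n → H n 1 - H (n ∸ 1) 1 ≡ inv n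
H[n]-H[n∸1]≡inv zero    = refl
H[n]-H[n∸1]≡inv (suc n) = trans (cong (_- H n 1) (sumFrom-snoc 1 n (λ t → pow (inv t) 1))) (cancel (H n 1) (inv (suc n)))
  where
  cancel : ∀ a x → (a + x * 1ℚ) - a ≡ x
  cancel = solve-∀ ℚ-ring

H[M]-H[M∸k]-null : ∀ k → Null (λ M → H M 1 - H (M ∸ k) 1)
H[M]-H[M∸k]-null zero    = Seq.Small-resp 0 (λ M _ → +-inverseʳ (H M 1)) Seq.Small-0
H[M]-H[M∸k]-null (suc k) = Seq.Small-resp 0 (λ M _ → telescope M)
  (Seq.Small-+ (H[M]-H[M∸k]-null k) (Seq.Small-resp 0 (λ M _ → H[n]-H[n∸1]≡inv (M ∸ k)) (Null-∘∸ k inv-null)))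
  where
  split : ∀ a b c → a - c ≡ (a - b) + (b - c)
  split = solve-∀ ℚ-ring
  telescope : ∀ M → H M 1 - H (M ∸ suc k) 1 ≡ (H M 1 - H (M ∸ k) 1) + (H (M ∸ k) 1 - H (M ∸ k ∸ 1) 1)
  telescope M = trans (cong (λ n → H M 1 - H n 1) M∸[1+k]≡M∸k∸1) (split (H M 1) (H (M ∸ k) 1) (H (M ∸ k ∸ 1) 1))
    where
    M∸[1+k]≡M∸k∸1 : M ∸ suc k ≡ M ∸ k ∸ 1
    M∸[1+k]≡M∸k∸1 = trans (cong (M ∸_) (ℕ.+-comm 1 k)) (sym (ℕ.∸-+-assoc M k 1))

pow-nonNeg : ∀ {x} n → 0ℚ ℚ.≤ x → 0ℚ ℚ.≤ pow x n
pow-nonNeg zero    0≤x = nonNegative⁻¹ 1ℚ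
pow-nonNeg {x} (suc n) 0≤x = subst (ℚ._≤ x * pow x n) (*-zeroʳ x)
  (*-monoˡ-≤-nonNeg x {{ℚ.nonNegative 0≤x}} (pow-nonNeg n 0≤x))

pow≤1 : ∀ {x} n → 0ℚ ℚ.≤ x → x ℚ.≤ 1ℚ → pow x n ℚ.≤ 1ℚ
pow≤1 zero    0≤x x≤1 = ≤-refl
pow≤1 {x} (suc n) 0≤x x≤1 = begin
  x * pow x n  ≤⟨ *-monoˡ-≤-nonNeg x {{ℚ.nonNegative 0≤x}} (pow≤1 n 0≤x x≤1) ⟩
  x * 1ℚ       ≡⟨ *-identityʳ x ⟩
  x            ≤⟨ x≤1 ⟩
  1ℚ           ∎
  where open ≤-Reasoning

pow[2+n]≤x*x : ∀ {x} n → 0ℚ ℚ.≤ x → x ℚ.≤ 1ℚ → pow x (suc (suc n)) ℚ.≤ x * x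
pow[2+n]≤x*x {x} n 0≤x x≤1 = *-monoˡ-≤-nonNeg x {{ℚ.nonNegative 0≤x}}
  (subst (x * pow x n ℚ.≤_) (*-identityʳ x) (*-monoˡ-≤-nonNeg x {{ℚ.nonNegative 0≤x}} (pow≤1 n 0≤x x≤1)))

-- 1/(n+2)^j ≤ 1/((n+1)(n+2)) = 1/(n+1) - 1/(n+2) for j ≥ 2
H+inv-suc-≤ : ∀ i n → H (suc (suc n)) (suc (suc i)) + inv (suc (suc n)) ℚ.≤ H (suc n) (suc (suc i)) + inv (suc n)
H+inv-suc-≤ i n = begin
  H (suc (suc n)) j + y            ≡⟨ cong (_+ y) (sumFrom-snoc 1 (suc n) (λ t → pow (inv t) j)) ⟩
  (H (suc n) j + pow y j) + y      ≡⟨ +-assoc (H (suc n) j) (pow y j) y ⟩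
  H (suc n) j + (pow y j + y)      ≤⟨ +-monoʳ-≤ (H (suc n) j) (+-monoˡ-≤ y powy≤w-y) ⟩
  H (suc n) j + (w - y + y)        ≡⟨ cong (H (suc n) j +_) (sub-add w y) ⟩
  H (suc n) j + w                  ∎
  where
  open ≤-Reasoning
  j = suc (suc i)
  y = inv (suc (suc n))
  w = inv (suc n)
  powy≤w-y : pow y j ℚ.≤ w - y
  powy≤w-y = begin
    pow y j  ≤⟨ pow[2+n]≤x*x i (inv-nonNeg (suc (suc n))) (inv≤1 (suc (suc n))) ⟩
    y * y    ≤⟨ *-monoʳ-≤-nonNeg y {{ℚ.nonNegative (inv-nonNeg (suc (suc n)))}} (inv-antimono (suc n) (suc (suc n)) (s≤s z≤n) (ℕ.n≤1+n (suc n))) ⟩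
    w * y    ≡⟨ inv*inv-partialFraction 1 n (s≤s z≤n) ⟩
    1ℚ * (w - y) ≡⟨ *-identityˡ (w - y) ⟩
    w - y    ∎
  sub-add : ∀ a b → a - b + b ≡ a
  sub-add = solve-∀ ℚ-ring

H+inv-antitone : ∀ i m d →
  H (suc m ℕ.+ d) (suc (suc i)) + inv (suc m ℕ.+ d) ℚ.≤ H (suc m) (suc (suc i)) + inv (suc m)
H+inv-antitone i m zero    = ≤-reflexive (cong (λ n → H n (suc (suc i)) + inv n) (ℕ.+-identityʳ (suc m)))
H+inv-antitone i m (suc d) =
  subst (λ n → H n (suc (suc i)) + inv n ℚ.≤ H (suc m) (suc (suc i)) + inv (suc m)) (sym (ℕ.+-suc (suc m) d))
    (≤-trans (H+inv-suc-≤ i (m ℕ.+ d)) (H+inv-antitone i m d))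

H-mono : ∀ j M d → H M j ℚ.≤ H (M ℕ.+ d) j
H-mono j M d = begin
  H M j                                          ≡⟨ sym (+-identityʳ (H M j)) ⟩
  H M j + 0ℚ                                     ≤⟨ +-monoʳ-≤ (H M j) (sumFrom-nonNeg (suc M) d _ (λ t → pow-nonNeg j (inv-nonNeg t))) ⟩
  H M j + sumFrom (suc M) d (λ t → pow (inv t) j) ≡⟨ sym (sumFrom-++ 1 M d (λ t → pow (inv t) j)) ⟩
  H (M ℕ.+ d) j                                  ∎
  where open ≤-Reasoning

∣H-H∣≤inv : ∀ i M M′ → 1 ≤ M → M ≤ M′ → ∣ H M′ (suc (suc i)) - H M (suc (suc i)) ∣ ℚ.≤ inv M
∣H-H∣≤inv i (suc m) M′ _ M≤M′ =
  subst (λ n → ∣ H n j - H (suc m) j ∣ ℚ.≤ inv (suc m)) (ℕ.m+[n∸m]≡n M≤M′) (bound (M′ ∸ suc m))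
  where
  j = suc (suc i)
  bound : ∀ d → ∣ H (suc m ℕ.+ d) j - H (suc m) j ∣ ℚ.≤ inv (suc m)
  bound d = begin
    ∣ H′ - H (suc m) j ∣                     ≡⟨ 0≤p⇒∣p∣≡p (p≤q⇒0≤q-p (H-mono j (suc m) d)) ⟩
    H′ - H (suc m) j                         ≤⟨ +-monoˡ-≤ (- H (suc m) j) (p≤p+q {H′} (inv-nonNeg (suc m ℕ.+ d))) ⟩
    H′ + inv (suc m ℕ.+ d) - H (suc m) j     ≤⟨ +-monoˡ-≤ (- H (suc m) j) (H+inv-antitone i m d) ⟩
    H (suc m) j + inv (suc m) - H (suc m) j  ≡⟨ cancel (H (suc m) j) (inv (suc m)) ⟩
    inv (suc m)                              ∎
    where
    open ≤-Reasoning
    H′ = H (suc m ℕ.+ d) j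
    cancel : ∀ a b → a + b - a ≡ b
    cancel = solve-∀ ℚ-ring

Cauchy-H : ∀ j → 2 ≤ j → Cauchy (λ M → H M j)
Cauchy-H (suc zero) (s≤s ())
Cauchy-H (suc (suc i)) _ = Pairs.Small-mono 1 bound
  (Pairs.Small-+ (Null-∘π proj₁ proj₁ inv-null) (Null-∘π proj₂ proj₂ inv-null))
  where
  j = suc (suc i)
  bound : ∀ q → 1 ≤ proj₁ q × 1 ≤ proj₂ q →
    ∣ H (proj₁ q) j - H (proj₂ q) j ∣ ℚ.≤ ∣ inv (proj₁ q) + inv (proj₂ q) ∣
  bound (M , M′) (1≤M , 1≤M′) =
    subst (∣ H M j - H M′ j ∣ ℚ.≤_) (sym (0≤p⇒∣p∣≡p (+-mono-≤ (inv-nonNeg M) (inv-nonNeg M′))))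
      (cases (ℕ.≤-total M M′))
    where
    open ≤-Reasoning
    cases : M ≤ M′ ⊎ M′ ≤ M → ∣ H M j - H M′ j ∣ ℚ.≤ inv M + inv M′
    cases (inj₁ M≤M′) = begin
      ∣ H M j - H M′ j ∣  ≡⟨ ∣p-q∣≡∣q-p∣ (H M j) (H M′ j) ⟩
      ∣ H M′ j - H M j ∣  ≤⟨ ∣H-H∣≤inv i M M′ 1≤M M≤M′ ⟩
      inv M               ≤⟨ p≤p+q (inv-nonNeg M′) ⟩
      inv M + inv M′      ∎
    cases (inj₂ M′≤M) = begin
      ∣ H M j - H M′ j ∣  ≤⟨ ∣H-H∣≤inv i M′ M 1≤M′ M′≤M ⟩
      inv M′              ≤⟨ p≤p+q (inv-nonNeg M) ⟩
      inv M′ + inv M      ≡⟨ +-comm (inv M′) (inv M) ⟩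
      inv M + inv M′      ∎

-- The telescoping identity

mixedPowers : ℚ → ℚ → ℕ → ℚ
mixedPowers y z q = sumFrom 2 q (λ j → pow y j * pow z (suc (suc q) ∸ j))

mixedPowers-suc : ∀ y z q → mixedPowers y z (suc q) ≡ pow y 2 * pow z (suc q) + y * mixedPowers y z q
mixedPowers-suc y z q = cong (pow y 2 * pow z (suc q) +_) (begin
  sumFrom 3 q f                                          ≡⟨ sumFrom-suc 2 q f ⟩
  sumFrom 2 q (λ j → y * pow y j * pow z (suc (suc q) ∸ j))  ≡⟨ sumFrom-ext 2 q (λ j → *-assoc y (pow y j) _) ⟩
  sumFrom 2 q (λ j → y * (pow y j * pow z (suc (suc q) ∸ j))) ≡⟨ sumFrom-*ˡ 2 q y _ ⟩
  y * mixedPowers y z q                                  ∎)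
  where
  open ≡-Reasoning
  f : ℕ → ℚ
  f j = pow y j * pow z (suc (suc (suc q)) ∸ j)

geometric-telescope : ∀ x y z → x * y ≡ z * (x - y) →
  ∀ q → x * pow y (suc q) + mixedPowers y z q ≡ pow z (suc q) * (x - y)
geometric-telescope x y z xy≡z[x-y] zero = begin
  x * (y * 1ℚ) + 0ℚ  ≡⟨ unit x y ⟩
  x * y              ≡⟨ xy≡z[x-y] ⟩
  z * (x - y)        ≡⟨ cong (_* (x - y)) (sym (*-identityʳ z)) ⟩
  z * 1ℚ * (x - y)   ∎
  where
  open ≡-Reasoning
  unit : ∀ x y → x * (y * 1ℚ) + 0ℚ ≡ x * y
  unit = solve-∀ ℚ-ring
geometric-telescope x y z xy≡z[x-y] (suc q) = begin
  x * (y * pow y (suc q)) + mixedPowers y z (suc q)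
    ≡⟨ cong (x * (y * pow y (suc q)) +_) (mixedPowers-suc y z q) ⟩
  x * (y * pow y (suc q)) + (y * (y * 1ℚ) * Z + y * mixedPowers y z q)
    ≡⟨ regroup x y (pow y (suc q)) (mixedPowers y z q) Z ⟩
  y * (x * pow y (suc q) + mixedPowers y z q) + y * y * Z
    ≡⟨ cong (λ t → y * t + y * y * Z) (geometric-telescope x y z xy≡z[x-y] q) ⟩
  y * (Z * (x - y)) + y * y * Z    ≡⟨ collapse x y Z ⟩
  Z * (x * y)                      ≡⟨ cong (Z *_) xy≡z[x-y] ⟩
  Z * (z * (x - y))                ≡⟨ reassoc x y z Z ⟩
  z * Z * (x - y)                  ∎
  where
  open ≡-Reasoning
  Z = pow z (suc q)
  regroup : ∀ x y P Q Z → x * (y * P) + (y * (y * 1ℚ) * Z + y * Q) ≡ y * (x * P + Q) + y * y * Z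
  regroup = solve-∀ ℚ-ring
  collapse : ∀ x y Z → y * (Z * (x - y)) + y * y * Z ≡ Z * (x * y)
  collapse = solve-∀ ℚ-ring
  reassoc : ∀ x y z Z → Z * (z * (x - y)) ≡ z * Z * (x - y)
  reassoc = solve-∀ ℚ-ring

-- Since inv 0 = 0, only the terms n > k contribute.
shiftedSum : ℕ → ℕ → ℕ → ℚ
shiftedSum p k M = sumFrom 1 M (λ n → inv (n ∸ k) * pow (inv n) p)

bracket : ℕ → ℕ → ℕ → ℚ
bracket p k M = H k 1 * pow (inv k) p + ΣFT 2 p (λ j → (H k j - zetaPartial j M) * pow (inv k) (suc p ∸ j))

shiftedSum[k]≡0 : ∀ p k → shiftedSum p k k ≡ 0ℚ
shiftedSum[k]≡0 p k = trans
  (sumFrom-cong 1 k λ n _ n<1+k →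
    trans (cong (λ d → inv d * pow (inv n) p) (ℕ.m≤n⇒m∸n≡0 (ℕ.≤-pred n<1+k))) (*-zeroˡ (pow (inv n) p)))
  (sumFrom-zero 1 k (λ _ _ → refl))

shiftedSum-suc : ∀ p k m → shiftedSum p k (suc (k ℕ.+ m)) ≡ shiftedSum p k (k ℕ.+ m) + inv (suc m) * pow (inv (suc (k ℕ.+ m))) p
shiftedSum-suc p k m = trans (sumFrom-snoc 1 (k ℕ.+ m) (λ n → inv (n ∸ k) * pow (inv n) p))
  (cong (λ d → shiftedSum p k (k ℕ.+ m) + inv d * pow (inv (suc (k ℕ.+ m))) p) k+1+m∸k≡1+m)
  where
  k+1+m∸k≡1+m : suc (k ℕ.+ m) ∸ k ≡ suc m
  k+1+m∸k≡1+m = trans (cong (_∸ k) (sym (ℕ.+-suc k m))) (ℕ.m+n∸m≡n k (suc m))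

bracket-suc : ∀ q k M → bracket (suc q) k (suc M) ≡ bracket (suc q) k M - mixedPowers (inv (suc M)) (inv k) q
bracket-suc q k M = trans (cong (H k 1 * pow (inv k) (suc q) +_) (begin
  sumFrom 2 q (λ j → (H k j - H (suc M) j) * w j)
    ≡⟨ sumFrom-ext 2 q (λ j → cong (λ h → (H k j - h) * w j) (sumFrom-snoc 1 M (λ t → pow (inv t) j))) ⟩
  sumFrom 2 q (λ j → (H k j - (H M j + pow y j)) * w j)
    ≡⟨ sumFrom-ext 2 q (λ j → split (H k j) (H M j) (pow y j) (w j)) ⟩
  sumFrom 2 q (λ j → (H k j - H M j) * w j - pow y j * w j)
    ≡⟨ sumFrom-- 2 q (λ j → (H k j - H M j) * w j) (λ j → pow y j * w j) ⟩
  sumFrom 2 q (λ j → (H k j - H M j) * w j) - mixedPowers y (inv k) q  ∎))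
  (sym (+-assoc (H k 1 * pow (inv k) (suc q)) _ _))
  where
  open ≡-Reasoning
  y = inv (suc M)
  w : ℕ → ℚ
  w j = pow (inv k) (suc (suc q) ∸ j)
  split : ∀ h h′ x w → (h - (h′ + x)) * w ≡ (h - h′) * w - x * w
  split = solve-∀ ℚ-ring

shiftedSum-bracket : ∀ q k m → 1 ≤ k →
  shiftedSum (suc q) k (k ℕ.+ m) - bracket (suc q) k (k ℕ.+ m) ≡ pow (inv k) (suc q) * (H m 1 - H (k ℕ.+ m) 1)
shiftedSum-bracket q k zero _ =
  subst (λ M → shiftedSum (suc q) k M - bracket (suc q) k M ≡ pow (inv k) (suc q) * (0ℚ - H M 1))
        (sym (ℕ.+-identityʳ k)) (begin
    shiftedSum (suc q) k k - (H k 1 * Z + sumFrom 2 q (λ j → (H k j - H k j) * w j))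
      ≡⟨ cong₂ (λ a b → a - (H k 1 * Z + b)) (shiftedSum[k]≡0 (suc q) k) (sumFrom-zero 2 q vanish) ⟩
    0ℚ - (H k 1 * Z + 0ℚ)  ≡⟨ rearrange (H k 1) Z ⟩
    Z * (0ℚ - H k 1)       ∎)
  where
  open ≡-Reasoning
  Z = pow (inv k) (suc q)
  w : ℕ → ℚ
  w j = pow (inv k) (suc (suc q) ∸ j)
  vanish : ∀ j → 2 ≤ j → (H k j - H k j) * w j ≡ 0ℚ
  vanish j _ = trans (cong (_* w j) (+-inverseʳ (H k j))) (*-zeroˡ (w j))
  rearrange : ∀ h Z → 0ℚ - (h * Z + 0ℚ) ≡ Z * (0ℚ - h)
  rearrange = solve-∀ ℚ-ring
shiftedSum-bracket q k (suc m) 1≤k =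
  subst (λ M′ → shiftedSum p k M′ - bracket p k M′ ≡ Z * (H (suc m) 1 - H M′ 1)) (sym (ℕ.+-suc k m)) (begin
    shiftedSum p k (suc M) - bracket p k (suc M)
      ≡⟨ cong₂ _-_ (shiftedSum-suc p k m) (bracket-suc q k M) ⟩
    (shiftedSum p k M + x * pow y p) - (bracket p k M - mixedPowers y z q)
      ≡⟨ regroup (shiftedSum p k M) (bracket p k M) (x * pow y p) (mixedPowers y z q) ⟩
    (shiftedSum p k M - bracket p k M) + (x * pow y p + mixedPowers y z q)
      ≡⟨ cong₂ _+_ (shiftedSum-bracket q k m 1≤k) (geometric-telescope x y z (inv*inv-partialFraction k m 1≤k) q) ⟩
    Z * (H m 1 - H M 1) + Z * (x - y)
      ≡⟨ collect Z (H m 1) (H M 1) x y ⟩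
    Z * ((H m 1 + x * 1ℚ) - (H M 1 + y * 1ℚ))
      ≡⟨ cong₂ (λ a b → Z * (a - b)) (sym (sumFrom-snoc 1 m (λ t → pow (inv t) 1))) (sym (sumFrom-snoc 1 M (λ t → pow (inv t) 1))) ⟩
    Z * (H (suc m) 1 - H (suc M) 1) ∎)
  where
  open ≡-Reasoning
  p = suc q
  M = k ℕ.+ m
  x = inv (suc m)
  y = inv (suc M)
  z = inv k
  Z = pow z p
  regroup : ∀ S B X Q → (S + X) - (B - Q) ≡ (S - B) + (X + Q)
  regroup = solve-∀ ℚ-ring
  collect : ∀ Z a b x y → Z * (a - b) + Z * (x - y) ≡ Z * ((a + x * 1ℚ) - (b + y * 1ℚ))
  collect = solve-∀ ℚ-ring

coefficient : ℕ → ℕ → ℚ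
coefficient r k = toℚ (r C k) * sgn k

lhsPartial-decomposition : ∀ p r M →
  lhsPartial p r M ≡ H M (suc p) + sumFrom 1 r (λ k → coefficient r k * shiftedSum p k M)
lhsPartial-decomposition p r M = begin
  sumFrom 1 M (λ n → hneg r n * pow (inv n) p)
    ≡⟨ sumFrom-cong 1 M (λ n 1≤n _ → cong (_* pow (inv n) p) (hneg≡hnegSum r n 1≤n)) ⟩
  sumFrom 1 M (λ n → hnegSum r n * pow (inv n) p)
    ≡⟨ sumFrom-ext 1 M (λ n → sym (sumFrom-*ʳ 0 (suc r) (pow (inv n) p) (λ k → coefficient r k * inv (n ∸ k)))) ⟩
  sumFrom 1 M (λ n → sumFrom 0 (suc r) (λ k → coefficient r k * inv (n ∸ k) * pow (inv n) p))
    ≡⟨ sumFrom-comm 1 M 0 (suc r) _ ⟩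
  sumFrom 0 (suc r) (λ k → sumFrom 1 M (λ n → coefficient r k * inv (n ∸ k) * pow (inv n) p))
    ≡⟨ sumFrom-ext 0 (suc r) (λ k → trans (sumFrom-ext 1 M (λ n → *-assoc (coefficient r k) _ _))
                                           (sumFrom-*ˡ 1 M (coefficient r k) _)) ⟩
  sumFrom 0 (suc r) (λ k → coefficient r k * shiftedSum p k M)
    ≡⟨ cong (_+ sumFrom 1 r (λ k → coefficient r k * shiftedSum p k M)) (*-identityˡ (H M (suc p))) ⟩
  H M (suc p) + sumFrom 1 r (λ k → coefficient r k * shiftedSum p k M) ∎
  where open ≡-Reasoning

lhsPartial-rhsApprox : ∀ p r M →
  lhsPartial p r M - rhsApprox p r M ≡ sumFrom 1 r (λ k → coefficient r k * (shiftedSum p k M - bracket p k M))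
lhsPartial-rhsApprox p r M = begin
  lhsPartial p r M - rhsApprox p r M
    ≡⟨ cong (_- rhsApprox p r M) (lhsPartial-decomposition p r M) ⟩
  (H M (suc p) + sumFrom 1 r (λ k → coefficient r k * shiftedSum p k M)) - rhsApprox p r M
    ≡⟨ cancel (H M (suc p)) _ _ ⟩
  sumFrom 1 r (λ k → coefficient r k * shiftedSum p k M) - sumFrom 1 r (λ k → sgn k * toℚ (r C k) * bracket p k M)
    ≡⟨ sym (sumFrom-- 1 r _ _) ⟩
  sumFrom 1 r (λ k → coefficient r k * shiftedSum p k M - sgn k * toℚ (r C k) * bracket p k M)
    ≡⟨ sumFrom-ext 1 r (λ k → factor (toℚ (r C k)) (sgn k) (shiftedSum p k M) (bracket p k M)) ⟩
  sumFrom 1 r (λ k → coefficient r k * (shiftedSum p k M - bracket p k M)) ∎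
  where
  open ≡-Reasoning
  cancel : ∀ h a b → (h + a) - (h + b) ≡ a - b
  cancel = solve-∀ ℚ-ring
  factor : ∀ c s T B → c * s * T - s * c * B ≡ c * s * (T - B)
  factor = solve-∀ ℚ-ring

lhsPartial-rhsApprox-eventually : ∀ q r M → r ≤ M → lhsPartial (suc q) r M - rhsApprox (suc q) r M ≡
  sumFrom 1 r (λ k → coefficient r k * (pow (inv k) (suc q) * (H (M ∸ k) 1 - H M 1)))
lhsPartial-rhsApprox-eventually q r M r≤M = trans (lhsPartial-rhsApprox (suc q) r M)
  (sumFrom-cong 1 r λ k 1≤k k<1+r → cong (coefficient r k *_)
    (subst (λ M′ → shiftedSum (suc q) k M′ - bracket (suc q) k M′ ≡ pow (inv k) (suc q) * (H (M ∸ k) 1 - H M′ 1))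
           (ℕ.m+[n∸m]≡n (ℕ.≤-trans (ℕ.≤-pred k<1+r) r≤M)) (shiftedSum-bracket q k (M ∸ k) 1≤k)))

lhsPartial-rhsApprox-null : ∀ q r → Null (λ M → lhsPartial (suc q) r M - rhsApprox (suc q) r M)
lhsPartial-rhsApprox-null q r = Seq.Small-resp r (lhsPartial-rhsApprox-eventually q r)
  (Seq.Small-sum 1 r _ λ k _ → Seq.Small-*ˡ (coefficient r k) (Seq.Small-*ˡ (pow (inv k) (suc q))
    (Seq.Small-resp 0 (λ M _ → negate (H (M ∸ k) 1) (H M 1)) (Seq.Small-*ˡ (- 1ℚ) (H[M]-H[M∸k]-null k)))))
  where
  negate : ∀ a b → a - b ≡ - 1ℚ * (b - a)
  negate = solve-∀ ℚ-ring

bracket-Cauchy : ∀ p k → Cauchy (bracket p k)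
bracket-Cauchy p k = Cauchy-+ {λ _ → H k 1 * pow (inv k) p} {λ M → sumFrom 2 (suc p ∸ 2) (λ j → f j M)}
  (Cauchy-const (H k 1 * pow (inv k) p))
  (Cauchy-sum 2 (suc p ∸ 2) f λ j 2≤j → Cauchy-*ʳ {λ M → H k j - H M j} (pow (inv k) (suc p ∸ j))
    (Cauchy-- {λ _ → H k j} {λ M → H M j} (Cauchy-const (H k j)) (Cauchy-H j 2≤j)))
  where
  f : ℕ → ℕ → ℚ
  f j M = (H k j - H M j) * pow (inv k) (suc p ∸ j)

rhsApprox-Cauchy : ∀ p r → 1 ≤ p → Cauchy (rhsApprox p r)
rhsApprox-Cauchy p r 1≤p = Cauchy-+ {λ M → H M (suc p)} {λ M → sumFrom 1 r (λ k → f k M)}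
  (Cauchy-H (suc p) (s≤s 1≤p))
  (Cauchy-sum 1 r f λ k _ → Cauchy-*ˡ {bracket p k} (sgn k * toℚ (r C k)) (bracket-Cauchy p k))
  where
  f : ℕ → ℕ → ℚ
  f k M = sgn k * toℚ (r C k) * bracket p k M

lhsPartial-Cauchy : ∀ q r → Cauchy (lhsPartial (suc q) r)
lhsPartial-Cauchy q r = Pairs.Small-resp 0 (λ (M , M′) _ → cong₂ _-_ (split (L M) (R M)) (split (L M′) (R M′)))
  (Cauchy-+ {R} {λ M → L M - R M} (rhsApprox-Cauchy (suc q) r (s≤s z≤n))
            (Null⇒Cauchy {λ M → L M - R M} (lhsPartial-rhsApprox-null q r)))
  where
  L R : ℕ → ℚ
  L = lhsPartial (suc q) r
  R = rhsApprox (suc q) r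
  split : ∀ a b → a ≡ b + (a - b)
  split = solve-∀ ℚ-ring

mainTheorem3 : (p r : ℕ) → 1 ≤ p → 1 ≤ r →
    ((ε : ℚ) → 0ℚ < ε → ∃[ N ] ((M M′ : ℕ) → N ≤ M → N ≤ M′ →
        ∣ lhsPartial p r M - lhsPartial p r M′ ∣ < ε))
    ×
    ((ε : ℚ) → 0ℚ < ε → ∃[ N ] ((M : ℕ) → N ≤ M →
        ∣ lhsPartial p r M - rhsApprox p r M ∣ < ε))
mainTheorem3 (suc q) r _ _ = lhs-Cauchy , lhsPartial-rhsApprox-null q r
  where
  lhs-Cauchy : (ε : ℚ) → 0ℚ < ε → ∃[ N ] ((M M′ : ℕ) → N ≤ M → N ≤ M′ →
    ∣ lhsPartial (suc q) r M - lhsPartial (suc q) r M′ ∣ < ε)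
  lhs-Cauchy ε ε>0 = map₂ (λ small M M′ N≤M N≤M′ → small (M , M′) (N≤M , N≤M′)) (lhsPartial-Cauchy q r ε ε>0)
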